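{- Let $k\geq 4$ and let $\mathbf{u}$, $\pi$ be as in the context. If $w$ is a factor of $\mathbf{u}$ with $\pi(w)=0101$, then $w=0101$.
   Context: Fix an integer $k\geq 4$. Let $\mathcal{A}=\{0,1,\ldots,k-1,0',1',\ldots,(k-1)'\}$. Let $\xi:\mathcal{A}^*\to\mathcal{A}^*$ be the morphism given by $\xi(0)=01$, $\xi(j)=j+1$ for $1\leq j\leq k-2$, $\xi(k-1)=0'$, and $\xi(0')=0'1'$, $\xi(j')=(j+1)'$ for $1\leq j\leq k-2$, $\xi((k-1)')=0$. Let $\mathbf{u}=\xi^\omega(0)$ be the infinite fixed point of $\xi$ starting with $0$. Let $\pi:\mathcal{A}^*\to\{0,1\}^*$ be the letter-to-letter morphism with $\pi(0)=0$, $\pi(j')=0$ for $1\leq j\leq k-1$, $\pi(0')=1$, $\pi(j)=1$ for $1\leq j\leq k-1$. -}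

module Defs where

open import Data.Nat using (ℕ; zero; suc; _+_; _<?_)
open import Data.Bool using (Bool; true; false; not)
open import Data.Product using (_×_; _,_; ∃)
open import Data.List using (List; []; _∷_; concatMap; map; upTo; length)
open import Relation.Nullary using (yes; no)
open import Relation.Binary.PropositionalEquality using (_≡_)

-- A letter j (unprimed) is (j , false); the letter j' is (j , true).
-- Only letters with j < k occur in the fixed point.
Letter : Set
Letter = ℕ × Bool

ξ₁ : ℕ → Letter → List Letter
ξ₁ k (zero , p) = (0 , p) ∷ (1 , p) ∷ []
ξ₁ k (suc j , p) with suc (suc j) <? k
... | yes _ = (suc (suc j) , p) ∷ []
... | no _  = (0 , not p) ∷ []           -- j+1 = k-1 :  (k-1) ↦ 0' and (k-1)' ↦ 0

ξ : ℕ → List Letter → List Letter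
ξ k = concatMap (ξ₁ k)

ξIter : ℕ → ℕ → List Letter
ξIter k zero = (0 , false) ∷ []
ξIter k (suc n) = ξ k (ξIter k n)

nth : {A : Set} → A → List A → ℕ → A
nth d [] n = d
nth d (x ∷ xs) zero = x
nth d (x ∷ xs) (suc n) = nth d xs n

-- the fixed point u = ξ^ω(0), as a function ℕ → Letter.
-- ξ^m(0) is a prefix of ξ^(m+1)(0) and has length ≥ m+1, so position n
-- of u is position n of ξ^(n+1)(0) (the default is never used).
u : ℕ → ℕ → Letter
u k n = nth (0 , false) (ξIter k (suc n)) n

IsFactor : ℕ → List Letter → Set
IsFactor k w = ∃ λ i → w ≡ map (λ t → u k (i + t)) (upTo (length w))

π₁ : Letter → ℕ
π₁ (zero , false) = 0
π₁ (zero , true) = 1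
π₁ (suc j , false) = 1
π₁ (suc j , true) = 0

π : List Letter → List ℕ
π = map π₁

{-# OPTIONS --safe #-}

-- Let σ be the cyclic successor 0 → 1 → ⋯ → k-1 → 0' → 1' → ⋯ → (k-1)' → 0.
-- Then ξ(x) = σ(x) unless x is a zero 0_p (0 or 0'), and ξ(0_p) = 0_p σ(0_p); so
-- every window of ξ(L) starts either at the first letter of some ξ(0_p) or at
-- the image σ(y) of a letter y of L.  Hence ξⁿ⁺¹(0) inherits from ξⁿ(0):
--   every letter is followed by 0, by 0', or by its σ-successor;
--   a zero 0_q not followed by 1_q is preceded by σ⁻¹(0_q);
--   a factor 0_q 1_q 0_q is preceded by 0_q.
-- Along such a step π changes value only when entering or leaving a zero, and
-- the last two properties then leave 0101 as the only factor projecting to 0101.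
module Submission where

open import Defs
open import Data.Nat using (ℕ; zero; suc; _+_; _≤_; _<_; _<?_; z≤n; s≤s)
open import Data.Nat.Properties using (≤-trans; n≤1+n; <⇒≤; +-monoʳ-<)
open import Data.Bool using (true; false; not)
open import Data.Bool.Properties using (not-¬)
open import Data.Product using (_,_; _×_; ∃; proj₂)
open import Data.Sum using (_⊎_; inj₁; inj₂)
open import Data.List using (List; []; _∷_; _++_; drop; tails; applyUpTo; length)
open import Data.List.Properties using (concatMap-++; map-upTo; ∷-injective)
open import Data.List.Relation.Unary.All using (All; []; _∷_)
open import Data.Unit using (⊤; tt)
open import Relation.Nullary using (yes; no; contradiction)
open import Relation.Binary.PropositionalEquality using (_≡_; _≢_; refl; sym; trans; cong; cong₂; subst)

AllTails : {A : Set} → (List A → Set) → List A → Set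
AllTails P xs = All P (tails xs)

allTails-drop : {A : Set} {P : List A → Set} → ∀ n xs → AllTails P xs → AllTails P (drop n xs)
allTails-drop zero xs ps = ps
allTails-drop (suc n) [] ps = ps
allTails-drop (suc n) (x ∷ xs) (_ ∷ ps) = allTails-drop n xs ps

module _ {A : Set} (d : A) where

  nth-++ˡ : ∀ xs {ys} j → j < length xs → nth d (xs ++ ys) j ≡ nth d xs j
  nth-++ˡ (x ∷ xs) zero _ = refl
  nth-++ˡ (x ∷ xs) (suc j) (s≤s j<n) = nth-++ˡ xs j j<n

  applyUpTo-prefix : ∀ (f : ℕ → A) n xs → n ≤ length xs →
                     (∀ {t} → t < n → f t ≡ nth d xs t) →
                     ∃ λ rest → xs ≡ applyUpTo f n ++ rest
  applyUpTo-prefix f zero xs _ _ = xs , refl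
  applyUpTo-prefix f (suc n) (x ∷ xs) (s≤s n≤) f≡
    with applyUpTo-prefix (λ t → f (suc t)) n xs n≤ (λ t<n → f≡ (s≤s t<n))
  ... | rest , xs≡ = rest , cong₂ _∷_ (sym (f≡ (s≤s z≤n))) xs≡

  applyUpTo-drop : ∀ (f : ℕ → A) i n xs → i + n ≤ length xs →
                   (∀ {t} → t < n → f t ≡ nth d xs (i + t)) →
                   ∃ λ rest → drop i xs ≡ applyUpTo f n ++ rest
  applyUpTo-drop f zero = applyUpTo-prefix f
  applyUpTo-drop f (suc i) n (x ∷ xs) (s≤s i+n≤) = applyUpTo-drop f i n xs i+n≤

module _ (k : ℕ) where

  σ : Letter → Letter
  σ (j , p) with suc j <? k
  ... | yes _ = suc j , p
  ... | no _ = 0 , not p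

  ξ-suc∷ : ∀ j p xs → ξ k ((suc j , p) ∷ xs) ≡ σ (suc j , p) ∷ ξ k xs
  ξ-suc∷ j p xs with suc (suc j) <? k
  ... | yes _ = refl
  ... | no _ = refl

  σ-suc≢1 : ∀ {j p q} → σ (suc j , p) ≢ (1 , q)
  σ-suc≢1 {j} with suc (suc j) <? k
  ... | yes _ = λ ()
  ... | no _ = λ ()

  σ-1≢0 : ∀ {q} → σ (1 , q) ≢ (0 , q)
  σ-1≢0 {q} with 2 <? k
  ... | yes _ = λ ()
  ... | no _ = λ e → not-¬ refl (sym (cong proj₂ e))

  π₁-σ-suc : ∀ j p → π₁ (σ (suc j , p)) ≡ π₁ (suc j , p)
  π₁-σ-suc j p with suc (suc j) <? k | p
  ... | yes _ | false = refl
  ... | yes _ | true = refl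
  ... | no _ | false = refl
  ... | no _ | true = refl

  -- An index σ a would block unification when matching, hence the equation.
  data Step (a : Letter) : Letter → Set where
    toZero : ∀ {q} → Step a (0 , q)
    toσ : ∀ {b} → b ≡ σ a → Step a b

  StepAt : List Letter → Set
  StepAt (a ∷ b ∷ _) = Step a b
  StepAt _ = ⊤

  LoneZeroAt : List Letter → Set
  LoneZeroAt (a ∷ b ∷ c ∷ _) = ∀ {q} → b ≡ (0 , q) → c ≢ (1 , q) → σ a ≡ (0 , q)
  LoneZeroAt _ = ⊤

  ZeroOneZeroAt : List Letter → Set
  ZeroOneZeroAt (a ∷ b ∷ c ∷ d ∷ _) =
    ∀ {q} → b ≡ (0 , q) → c ≡ (1 , q) → d ≡ (0 , q) → a ≡ (0 , q)
  ZeroOneZeroAt _ = ⊤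

  stepAt-ξ : ∀ {y} M → StepAt (y ∷ M) → StepAt (σ y ∷ ξ k M)
  stepAt-ξ [] _ = tt
  stepAt-ξ ((zero , q) ∷ M) _ = toZero
  stepAt-ξ ((suc j , q) ∷ M) (toσ z≡σy) rewrite ξ-suc∷ j q M = toσ (cong σ z≡σy)

  loneZeroAt-ξ : ∀ {y} M → StepAt (y ∷ M) → LoneZeroAt (σ y ∷ ξ k M)
  loneZeroAt-ξ [] _ = tt
  loneZeroAt-ξ ((zero , r) ∷ M) _ refl c≢1 = contradiction refl c≢1
  loneZeroAt-ξ ((suc j , r) ∷ M) (toσ z≡σy) rewrite ξ-suc∷ j r M with ξ k M
  ... | [] = tt
  ... | _ ∷ _ = λ σz≡0 _ → trans (cong σ (sym z≡σy)) σz≡0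

  zeroOneZeroAt-ξ : ∀ {y} M → LoneZeroAt (y ∷ M) → ZeroOneZeroAt (σ y ∷ ξ k M)
  zeroOneZeroAt-ξ [] _ = tt
  zeroOneZeroAt-ξ ((zero , r) ∷ []) _ = tt
  zeroOneZeroAt-ξ ((zero , r) ∷ (zero , s) ∷ M) lz refl refl refl = lz refl λ ()
  zeroOneZeroAt-ξ ((zero , r) ∷ (suc j , s) ∷ M) lz rewrite ξ-suc∷ j s M =
    λ { refl refl σz≡0 → lz refl λ { refl → σ-1≢0 σz≡0 } }
  zeroOneZeroAt-ξ ((suc j , r) ∷ []) _ rewrite ξ-suc∷ j r [] = tt
  zeroOneZeroAt-ξ ((suc j , r) ∷ (zero , s) ∷ M) _ rewrite ξ-suc∷ j r ((zero , s) ∷ M) = λ _ ()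
  zeroOneZeroAt-ξ ((suc j , r) ∷ (suc j′ , s) ∷ M) _
    rewrite ξ-suc∷ j r ((suc j′ , s) ∷ M) | ξ-suc∷ j′ s M with ξ k M
  ... | [] = tt
  ... | _ ∷ _ = λ _ c≡1 _ → contradiction c≡1 σ-suc≢1

  ξIter-head : ∀ n → ∃ λ t → ξIter k n ≡ (0 , false) ∷ t
  ξIter-head zero = [] , refl
  ξIter-head (suc n) with ξIter-head n
  ... | t , eq = (1 , false) ∷ ξ k t , cong (ξ k) eq

  ξIter-prefix : ∀ {m n} → m ≤ n → ∃ λ r → ξIter k n ≡ ξIter k m ++ r
  ξIter-prefix {n = n} z≤n = ξIter-head n
  ξIter-prefix {suc m} (s≤s m≤n) with ξIter-prefix m≤n
  ... | r , eq = ξ k r , trans (cong (ξ k) eq) (concatMap-++ (ξ₁ k) (ξIter k m) r)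

  length-ξ : ∀ xs → length xs ≤ length (ξ k xs)
  length-ξ [] = z≤n
  length-ξ ((zero , p) ∷ xs) = s≤s (≤-trans (length-ξ xs) (n≤1+n _))
  length-ξ ((suc j , p) ∷ xs) rewrite ξ-suc∷ j p xs = s≤s (length-ξ xs)

  length-ξIter : ∀ n → n < length (ξIter k n)
  length-ξIter zero = s≤s z≤n
  length-ξIter (suc n) with ξIter-head n | length-ξIter n
  ... | t , eq | n<len rewrite eq = s≤s (≤-trans n<len (s≤s (length-ξ t)))

  u-nth : ∀ {j n} → j < n → u k j ≡ nth (0 , false) (ξIter k n) j
  u-nth {j} j<n with ξIter-prefix j<n
  ... | r , eq = sym (trans (cong (λ xs → nth (0 , false) xs j) eq)
                            (nth-++ˡ _ (ξIter k (suc j)) j (≤-trans (n≤1+n _) (length-ξIter (suc j)))))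

  factor-in-ξIter : ∀ {w} → IsFactor k w →
                    ∃ λ n → ∃ λ i → ∃ λ rest → drop i (ξIter k n) ≡ w ++ rest
  factor-in-ξIter {w} (i , w≡)
    with applyUpTo-drop (0 , false) (λ t → u k (i + t)) i (length w) (ξIter k (i + length w))
                        (<⇒≤ (length-ξIter _)) (λ t<n → u-nth (+-monoʳ-< i t<n))
  ... | rest , eq =
    i + length w , i , rest , trans eq (cong (_++ rest) (sym (trans w≡ (map-upTo _ (length w)))))

  module _ (1<k : 1 < k) where

    σ-0 : ∀ {p} → σ (0 , p) ≡ (1 , p)
    σ-0 with 1 <? k
    ... | yes _ = refl
    ... | no 1≮k = contradiction 1<k 1≮k

    allTails-ξ : {P Q : List Letter → Set} →
                 (∀ {y} M → Q (y ∷ M) → P (σ y ∷ ξ k M)) →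
                 (∀ {p} M → P ((0 , p) ∷ (1 , p) ∷ ξ k M)) →
                 P [] → ∀ L → AllTails Q L → AllTails P (ξ k L)
    allTails-ξ _ _ atEnd [] _ = atEnd ∷ []
    allTails-ξ {P} atσ atZero atEnd ((zero , p) ∷ M) (q ∷ qs) =
      atZero M ∷ subst (λ x → P (x ∷ ξ k M)) σ-0 (atσ M q) ∷ allTails-ξ atσ atZero atEnd M qs
    allTails-ξ atσ atZero atEnd ((suc j , p) ∷ M) (q ∷ qs) rewrite ξ-suc∷ j p M =
      atσ M q ∷ allTails-ξ atσ atZero atEnd M qs

    stepAt-ξIter : ∀ n → AllTails StepAt (ξIter k n)
    stepAt-ξIter zero = tt ∷ tt ∷ []
    stepAt-ξIter (suc n) = allTails-ξ stepAt-ξ (λ _ → toσ (sym σ-0)) tt (ξIter k n) (stepAt-ξIter n)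

    loneZeroAt-ξIter : ∀ n → AllTails LoneZeroAt (ξIter k n)
    loneZeroAt-ξIter zero = tt ∷ tt ∷ []
    loneZeroAt-ξIter (suc n) = allTails-ξ loneZeroAt-ξ atZero tt (ξIter k n) (stepAt-ξIter n)
      where
      atZero : ∀ {p} M → LoneZeroAt ((0 , p) ∷ (1 , p) ∷ ξ k M)
      atZero M with ξ k M
      ... | [] = tt
      ... | _ ∷ _ = λ ()

    zeroOneZeroAt-ξIter : ∀ n → AllTails ZeroOneZeroAt (ξIter k n)
    zeroOneZeroAt-ξIter zero = tt ∷ tt ∷ []
    zeroOneZeroAt-ξIter (suc n) = allTails-ξ zeroOneZeroAt-ξ atZero tt (ξIter k n) (loneZeroAt-ξIter n)
      where
      atZero : ∀ {p} M → ZeroOneZeroAt ((0 , p) ∷ (1 , p) ∷ ξ k M)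
      atZero M with ξ k M
      ... | [] = tt
      ... | _ ∷ [] = tt
      ... | _ ∷ _ ∷ _ = λ ()

    σ≡zero⇒π₁≡ : ∀ {a q} → σ a ≡ (0 , q) → π₁ a ≡ π₁ (0 , q)
    σ≡zero⇒π₁≡ {zero , p} σa≡0 = contradiction (trans (sym σ-0) σa≡0) λ ()
    σ≡zero⇒π₁≡ {suc j , p} σa≡0 = trans (sym (π₁-σ-suc j p)) (cong π₁ σa≡0)

    step-rise : ∀ {a b} → Step a b → π₁ a ≡ 0 → π₁ b ≡ 1 →
                (a ≡ (0 , false) × b ≡ (1 , false)) ⊎ b ≡ (0 , true)
    step-rise (toZero {false}) _ ()
    step-rise (toZero {true}) _ _ = inj₂ refl
    step-rise {zero , false} (toσ refl) _ _ = inj₁ (refl , σ-0)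
    step-rise {zero , true} (toσ _) () _
    step-rise {suc j , p} (toσ refl) πa≡0 πb≡1 =
      contradiction (trans (sym πb≡1) (trans (π₁-σ-suc j p) πa≡0)) λ ()

    step-fall : ∀ {a b} → Step a b → π₁ a ≡ 1 → π₁ b ≡ 0 →
                (a ≡ (0 , true) × b ≡ (1 , true)) ⊎ b ≡ (0 , false)
    step-fall (toZero {false}) _ _ = inj₂ refl
    step-fall (toZero {true}) _ ()
    step-fall {zero , false} (toσ _) () _
    step-fall {zero , true} (toσ refl) _ _ = inj₁ (refl , σ-0)
    step-fall {suc j , p} (toσ refl) πa≡1 πb≡0 =
      contradiction (trans (sym πa≡1) (trans (sym (π₁-σ-suc j p)) πb≡0)) λ ()

    window-0101 : ∀ {a b c d} → Step a b → Step b c → Step c d →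
                  LoneZeroAt (a ∷ b ∷ c ∷ []) → LoneZeroAt (b ∷ c ∷ d ∷ []) →
                  ZeroOneZeroAt (a ∷ b ∷ c ∷ d ∷ []) →
                  π₁ a ≡ 0 → π₁ b ≡ 1 → π₁ c ≡ 0 → π₁ d ≡ 1 →
                  _≡_ {A = List Letter} (a ∷ b ∷ c ∷ d ∷ [])
                                        ((0 , false) ∷ (1 , false) ∷ (0 , false) ∷ (1 , false) ∷ [])
    window-0101 ab bc cd abc bcd abcd πa πb πc πd with step-rise ab πa πb
    ... | inj₂ refl with step-fall bc πb πc
    ...   | inj₂ refl = contradiction (trans (sym πa) (σ≡zero⇒π₁≡ (abc refl λ ()))) λ ()
    ...   | inj₁ (_ , refl) with step-rise cd πc πd
    ...     | inj₁ (() , _)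
    ...     | inj₂ refl = contradiction (trans (sym πa) (cong π₁ (abcd refl refl refl))) λ ()
    window-0101 ab bc cd abc bcd abcd πa πb πc πd | inj₁ (refl , refl) with step-fall bc πb πc
    ...   | inj₁ (() , _)
    ...   | inj₂ refl with step-rise cd πc πd
    ...     | inj₁ (_ , refl) = refl
    ...     | inj₂ refl = contradiction (σ≡zero⇒π₁≡ (bcd refl λ ())) λ ()

    prefix-π-0101 : ∀ w rest → AllTails StepAt (w ++ rest) → AllTails LoneZeroAt (w ++ rest) →
                    AllTails ZeroOneZeroAt (w ++ rest) → π w ≡ 0 ∷ 1 ∷ 0 ∷ 1 ∷ [] →
                    w ≡ (0 , false) ∷ (1 , false) ∷ (0 , false) ∷ (1 , false) ∷ []
    prefix-π-0101 (a ∷ b ∷ c ∷ d ∷ []) _ (ab ∷ bc ∷ cd ∷ _) (abc ∷ bcd ∷ _) (abcd ∷ _) πw =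
      let πa , πbcd = ∷-injective πw
          πb , πcd = ∷-injective πbcd
          πc , πd∷[] = ∷-injective πcd
          πd , _ = ∷-injective πd∷[]
      in window-0101 ab bc cd abc bcd abcd πa πb πc πd

    factor-π-0101 : ∀ w → IsFactor k w → π w ≡ 0 ∷ 1 ∷ 0 ∷ 1 ∷ [] →
                    w ≡ (0 , false) ∷ (1 , false) ∷ (0 , false) ∷ (1 , false) ∷ []
    factor-π-0101 w factor with factor-in-ξIter factor
    ... | n , i , rest , eq =
      prefix-π-0101 w rest (inFactor (stepAt-ξIter n)) (inFactor (loneZeroAt-ξIter n))
                           (inFactor (zeroOneZeroAt-ξIter n))
      where
      inFactor : ∀ {P} → AllTails P (ξIter k n) → AllTails P (w ++ rest)
      inFactor all = subst (AllTails _) eq (allTails-drop i _ all)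

mainTheorem7 : (k : ℕ) → 4 ≤ k → (w : List Letter) → IsFactor k w →
    π w ≡ 0 ∷ 1 ∷ 0 ∷ 1 ∷ [] →
    w ≡ (0 , false) ∷ (1 , false) ∷ (0 , false) ∷ (1 , false) ∷ []
mainTheorem7 k 4≤k = factor-π-0101 k (≤-trans (s≤s (s≤s z≤n)) 4≤k)
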